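{- Let $G$ be a finite, simple, undirected, connected, non-complete graph on $n$ vertices with vertex set $V$, edge set $E$, minimum degree $\delta$ and independence number $\alpha(G)$. For integers $t$ with $2\le t\le n-\delta$ let $$a(G,t)=\sum_{u\in V}\binom{n-d(u)-1}{t-1},\qquad b(G,t)=2\sum_{\{u,v\}\in\binom{V}{2}\setminus E}\left(\binom{n-d(u)-1}{t-2}+\binom{n-d(v)-1}{t-2}-\binom{n-|N[u]\cup N[v]|}{t-2}\right).$$ Then $$\alpha(G)\ge\alpha_{HM}(G):=\max_{2\le t\le n-\delta}\left(2t-1-\frac{b(G,t)}{a(G,t)}\right).$$
   Context: For $u\in V$, $N(u)$ is the neighborhood, $d(u)=|N(u)|$ and $N[u]=N(u)\cup\{u\}$. $\binom{V}{2}$ is the set of 2-element subsets of $V$. Binomial coefficients $\binom{m}{k}$ count $k$-element subsets of an $m$-element set, with $\binom{m}{k}=0$ if $k<0$ or $k>m$. An independent set is a set of pairwise non-adjacent vertices; $\alpha(G)$ is the maximum cardinality of an independent set. (Since $G$ is connected and non-complete, $n\ge3$ and $\delta\le n-2$, so the range of $t$ is nonempty and $a(G,t)>0$.) -}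

module Defs where

open import Data.Bool using (Bool; true; false; if_then_else_; _∧_; _∨_; not)
open import Data.Nat using (ℕ; zero; suc; _+_; _*_; _∸_; _⊓_; _⊔_; _<ᵇ_)
open import Data.Nat.Combinatorics using (_C_)
open import Data.Fin using (Fin; toℕ; _≟_)
open import Data.Fin.Subset using (Subset; _∈_; ∣_∣)
open import Data.Nat.ListAction using (sum)
open import Data.List using (List; []; _∷_; map; foldr; allFin; filter; length; concatMap)
open import Data.Vec using (Vec; []; _∷_; lookup)
open import Data.Product using (Σ; ∃; _×_)
open import Relation.Binary.PropositionalEquality using (_≡_; _≢_)
open import Relation.Nullary.Decidable using (⌊_⌋)
open import Data.Integer as ℤ using (ℤ; +_)
open import Data.Rational as ℚ using (ℚ)

record Graph (n : ℕ) : Set where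
  field
    adj   : Fin n → Fin n → Bool
    sym   : ∀ u v → adj u v ≡ adj v u
    irrfl : ∀ u → adj u u ≡ false
open Graph public

count : ∀ {n} → (Fin n → Bool) → ℕ
count {n} p = length (filter (λ w → Data.Bool._≟_ (p w) true) (allFin n))

deg : ∀ {n} → Graph n → Fin n → ℕ
deg G u = count (adj G u)

-- minimum degree δ (for n ≥ 1 this is the true minimum, degrees being ≤ n-1)
minDeg : ∀ {n} → Graph n → ℕ
minDeg {n} G = foldr _⊓_ n (map (deg G) (allFin n))

closedUnionSize : ∀ {n} → Graph n → Fin n → Fin n → ℕ
closedUnionSize G u v =
  count (λ w → ⌊ w ≟ u ⌋ ∨ ⌊ w ≟ v ⌋ ∨ adj G u w ∨ adj G v w)

data Reach {n : ℕ} (G : Graph n) : Fin n → Fin n → Set where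
  here : ∀ {u} → Reach G u u
  step : ∀ {u w v} → adj G u w ≡ true → Reach G w v → Reach G u v

Connected : ∀ {n} → Graph n → Set
Connected {n} G = ∀ (u v : Fin n) → Reach G u v

NonComplete : ∀ {n} → Graph n → Set
NonComplete {n} G = Σ (Fin n) λ u → Σ (Fin n) λ v → u ≢ v × adj G u v ≡ false

IsIndependent : ∀ {n} → Graph n → Subset n → Set
IsIndependent {n} G S = ∀ (u v : Fin n) → u ∈ S → v ∈ S → adj G u v ≡ false

independent? : ∀ {n} → Graph n → Subset n → Bool
independent? {n} G S =
  foldr _∧_ true
    (concatMap (λ u → map (λ v → not (lookup S u ∧ lookup S v ∧ adj G u v))
                          (allFin n)) (allFin n))

allSubsets : ∀ n → List (Subset n)
allSubsets zero = [] ∷ []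
allSubsets (suc n) =
  concatMap (λ S → (false ∷ S) ∷ (true ∷ S) ∷ []) (allSubsets n)

indepNum : ∀ {n} → Graph n → ℕ
indepNum {n} G =
  foldr _⊔_ 0
    (map (λ S → if independent? G S then ∣ S ∣ else 0) (allSubsets n))

aGt : ∀ {n} → Graph n → ℕ → ℕ
aGt {n} G t = sum (map (λ u → (n ∸ deg G u ∸ 1) C (t ∸ 1)) (allFin n))

pairTerm : ∀ {n} → Graph n → ℕ → Fin n → Fin n → ℤ
pairTerm {n} G t u v =
  (+ ((n ∸ deg G u ∸ 1) C (t ∸ 2)) ℤ.+ + ((n ∸ deg G v ∸ 1) C (t ∸ 2)))
  ℤ.- + ((n ∸ closedUnionSize G u v) C (t ∸ 2))

bGt : ∀ {n} → Graph n → ℕ → ℤ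
bGt {n} G t =
  + 2 ℤ.* foldr ℤ._+_ (+ 0)
    (concatMap (λ u → map (λ v →
        if (toℕ u <ᵇ toℕ v) ∧ not (adj G u v) then pairTerm G t u v else + 0)
      (allFin n)) (allFin n))

-- b / a as a rational (a > 0 in the theorem's range; a = 0 never occurs there)
ratio : ℤ → ℕ → ℚ
ratio b zero = ℚ.0ℚ
ratio b (suc k) = b ℚ./ suc k

hmTerm : ∀ {n} → Graph n → ℕ → ℚ
hmTerm G t = (ℚ._/_ (+ (2 * t ∸ 1)) 1) ℚ.- ratio (bGt G t) (aGt G t)

-- Write t = k + 2 and, for a
-- vertex u, let M(u) be the non-neighbours of u other than u, so |M(u)| = n - d(u) - 1 and
-- |M(u) ∩ M(v)| = n - |N[u] ∪ N[v]| for v ∈ M(u).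
--  * For every (k+1)-subset T of M(u), u together with the vertices isolated in G[T] is
--    independent, so 1 + iso(T) ≤ α(G).  Summing over T and double counting the pairs (T, v)
--    with v isolated in T gives, with m = |M(u)|,
--        C(m, k+1) + Σ_{v ∈ M(u)} C(n - |N[u] ∪ N[v]|, k) ≤ α(G)·C(m, k+1).
--  * Adding the absorption bound 2(k+1)·C(m, k+1) ≤ 2m·C(m, k) and summing over u gives
--    (2t-1)·a + 2·pairs⁻ ≤ α(G)·a + 2·pairs⁺, where b = 2(pairs⁺ - pairs⁻) and the sums over
--    unordered non-edges {u, v} are rewritten as sums over u and v ∈ M(u).
--  * A vertex of minimum degree makes a = a(G,t) positive; dividing by a gives the claim.

module Submission where

open import Defs
open import Data.Nat using (ℕ; _≤_; _∸_)
open import Data.Rational as ℚ using (ℚ)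
open import Data.Integer using (+_)

open import Data.Bool using (Bool; true; false; if_then_else_; _∧_; _∨_; not; T)
import Data.Bool as Bool
open import Data.Bool.Properties using (∨-zeroʳ; ∧-zeroʳ)
open import Data.Bool.ListAction using (all)
open import Data.Nat using (zero; suc; _+_; _*_; _<_; z≤n; s≤s; _⊔_; _⊓_; _<ᵇ_)
import Data.Nat.Properties as ℕₚ
open import Data.Nat.Combinatorics using (_C_; nCk+nC[k+1]≡[n+1]C[k+1])
open import Data.Nat.ListAction using (sum)
open import Data.Nat.Tactic.RingSolver using (solve-∀)
open import Data.Integer as ℤ using (ℤ)
import Data.Integer.Properties as ℤₚ
open import Data.Integer.Tactic.RingSolver renaming (solve-∀ to ℤ-solve-∀)
import Data.Rational.Properties as ℚₚ
open import Data.Rational.Unnormalised as ℚᵘ using (mkℚᵘ)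
import Data.Rational.Unnormalised.Properties as ℚᵘₚ
open import Data.List using (List; []; _∷_; map; _++_; length; filter; filterᵇ; tabulate; allFin; foldr; concatMap)
import Data.List.Properties as Lₚ
open import Data.Fin using (Fin; zero; suc)
import Data.Fin as Fin
import Data.Fin.Properties as Finₚ
open import Data.Fin.Subset using (Subset; ∣_∣)
import Data.Vec as Vec
import Data.Vec.Properties as Vecₚ
open import Data.Product using (_×_; _,_; proj₁; proj₂; Σ)
open import Data.Sum using (inj₁; inj₂)
open import Data.Unit using (⊤; tt)
open import Data.Empty using (⊥-elim)
open import Relation.Nullary using (yes; no; ¬_)
open import Relation.Nullary.Decidable using (⌊_⌋)
open import Relation.Binary.Definitions using (DecidableEquality; tri<; tri≈; tri>)
open import Relation.Binary.PropositionalEquality as ≡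
  using (_≡_; _≢_; refl; cong; cong₂; trans; subst; subst₂; module ≡-Reasoning)

∑ : ∀ {a} {A : Set a} → List A → (A → ℕ) → ℕ
∑ xs f = sum (map f xs)

𝟙 : Bool → ℕ
𝟙 true = 1
𝟙 false = 0

onlyIf : Bool → ℕ → ℕ
onlyIf b x = if b then x else 0

∧-true : ∀ {a b : Bool} → (a ∧ b) ≡ true → a ≡ true × b ≡ true
∧-true {true} {true} _ = refl , refl

∨-false : ∀ {a b : Bool} → (a ∨ b) ≡ false → a ≡ false × b ≡ false
∨-false {false} {false} _ = refl , refl

onlyIf-∧ : ∀ a b x → onlyIf (a ∧ b) x ≡ onlyIf a (onlyIf b x)
onlyIf-∧ true b x = refl
onlyIf-∧ false b x = refl

onlyIf-+ : ∀ b x y → onlyIf b (x + y) ≡ onlyIf b x + onlyIf b y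
onlyIf-+ true x y = refl
onlyIf-+ false x y = refl

module _ {a} {A : Set a} where

  ∑-cong : ∀ (xs : List A) {f g : A → ℕ} → (∀ x → f x ≡ g x) → ∑ xs f ≡ ∑ xs g
  ∑-cong [] h = refl
  ∑-cong (x ∷ xs) h = cong₂ _+_ (h x) (∑-cong xs h)

  ∑-const : ∀ (xs : List A) c → ∑ xs (λ _ → c) ≡ length xs * c
  ∑-const [] c = refl
  ∑-const (x ∷ xs) c = cong (_+_ c) (∑-const xs c)

  ∑-zero : ∀ (xs : List A) → ∑ xs (λ _ → 0) ≡ 0
  ∑-zero xs = trans (∑-const xs 0) (ℕₚ.*-zeroʳ (length xs))

  ∑-+ : ∀ (xs : List A) (f g : A → ℕ) → ∑ xs (λ x → f x + g x) ≡ ∑ xs f + ∑ xs g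
  ∑-+ [] f g = refl
  ∑-+ (x ∷ xs) f g = trans (cong (_+_ (f x + g x)) (∑-+ xs f g)) (interchange (f x) (g x) _ _)
    where interchange : ∀ a b c d → a + b + (c + d) ≡ a + c + (b + d)
          interchange = solve-∀

  ∑-* : ∀ (xs : List A) c (f : A → ℕ) → ∑ xs (λ x → c * f x) ≡ c * ∑ xs f
  ∑-* [] c f = ≡.sym (ℕₚ.*-zeroʳ c)
  ∑-* (x ∷ xs) c f = trans (cong (_+_ (c * f x)) (∑-* xs c f)) (≡.sym (ℕₚ.*-distribˡ-+ c (f x) _))

  ∑-++ : ∀ (xs ys : List A) (f : A → ℕ) → ∑ (xs ++ ys) f ≡ ∑ xs f + ∑ ys f
  ∑-++ [] ys f = refl
  ∑-++ (x ∷ xs) ys f = trans (cong (_+_ (f x)) (∑-++ xs ys f)) (≡.sym (ℕₚ.+-assoc (f x) _ _))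

  ∑-mono : ∀ (xs : List A) {f g : A → ℕ} → (∀ x → f x ≤ g x) → ∑ xs f ≤ ∑ xs g
  ∑-mono [] h = z≤n
  ∑-mono (x ∷ xs) h = ℕₚ.+-mono-≤ (h x) (∑-mono xs h)

  ∑-≤-const : ∀ (xs : List A) c {f : A → ℕ} → (∀ x → f x ≤ c) → ∑ xs f ≤ length xs * c
  ∑-≤-const xs c h = ℕₚ.≤-trans (∑-mono xs h) (ℕₚ.≤-reflexive (∑-const xs c))

  ∑-filter : ∀ (p : A → Bool) (xs : List A) (f : A → ℕ) →
             ∑ (filterᵇ p xs) f ≡ ∑ xs (λ x → onlyIf (p x) (f x))
  ∑-filter p [] f = refl
  ∑-filter p (x ∷ xs) f with p x
  ... | true = cong (_+_ (f x)) (∑-filter p xs f)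
  ... | false = ∑-filter p xs f

  length-filter : ∀ (p : A → Bool) (xs : List A) → length (filterᵇ p xs) ≡ ∑ xs (λ x → 𝟙 (p x))
  length-filter p [] = refl
  length-filter p (x ∷ xs) with p x
  ... | true = cong suc (length-filter p xs)
  ... | false = length-filter p xs

module _ {a b} {A : Set a} {B : Set b} where

  ∑-map : ∀ (h : A → B) (xs : List A) (f : B → ℕ) → ∑ (map h xs) f ≡ ∑ xs (λ x → f (h x))
  ∑-map h [] f = refl
  ∑-map h (x ∷ xs) f = cong (_+_ (f (h x))) (∑-map h xs f)

  ∑-swap : ∀ (xs : List A) (ys : List B) (f : A → B → ℕ) →
           ∑ xs (λ x → ∑ ys (f x)) ≡ ∑ ys (λ y → ∑ xs (λ x → f x y))
  ∑-swap [] ys f = ≡.sym (∑-zero ys)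
  ∑-swap (x ∷ xs) ys f =
    trans (cong (_+_ (∑ ys (f x))) (∑-swap xs ys f)) (≡.sym (∑-+ ys (f x) (λ y → ∑ xs (λ x' → f x' y))))

attained-min : ∀ {A : Set} (f : A → ℕ) b xs → foldr _⊓_ b (map f xs) < b →
               Σ A (λ x → f x ≤ foldr _⊓_ b (map f xs))
attained-min f b [] b<b = ⊥-elim (ℕₚ.<-irrefl refl b<b)
attained-min f b (x ∷ xs) min<b with ℕₚ.≤-total (f x) (foldr _⊓_ b (map f xs))
... | inj₁ fx≤ = x , ℕₚ.≤-reflexive (≡.sym (ℕₚ.m≤n⇒m⊓n≡m fx≤))
... | inj₂ ≤fx rewrite ℕₚ.m≥n⇒m⊓n≡n ≤fx = attained-min f b xs min<b

-- Binomial coefficients by Pascal's rule (convenient for induction); `bin≡C`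
-- identifies them with the library's _C_, in which the statement is phrased.
bin : ℕ → ℕ → ℕ
bin zero zero = 1
bin zero (suc k) = 0
bin (suc m) zero = 1
bin (suc m) (suc k) = bin m k + bin m (suc k)

bin≡C : ∀ m k → bin m k ≡ m C k
bin≡C zero zero = refl
bin≡C zero (suc k) = refl
bin≡C (suc m) zero = refl
bin≡C (suc m) (suc k) =
  trans (cong₂ _+_ (bin≡C m k) (bin≡C m (suc k))) (nCk+nC[k+1]≡[n+1]C[k+1] m k)

bin-0 : ∀ m → bin m 0 ≡ 1
bin-0 zero = refl
bin-0 (suc m) = refl

bin-pos : ∀ m k → k ≤ m → 1 ≤ bin m k
bin-pos m zero _ = ℕₚ.≤-reflexive (≡.sym (bin-0 m))
bin-pos (suc m) (suc k) (s≤s k≤m) = ℕₚ.≤-trans (bin-pos m k k≤m) (ℕₚ.m≤m+n (bin m k) _)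

bin-mono : ∀ m k → bin m k ≤ bin (suc m) k
bin-mono m zero = ℕₚ.≤-reflexive (bin-0 m)
bin-mono m (suc k) = ℕₚ.m≤n+m (bin m (suc k)) (bin m k)

bin-1 : ∀ m → bin m 1 ≡ m
bin-1 zero = refl
bin-1 (suc m) = cong₂ _+_ (bin-0 m) (bin-1 m)

bin-absorb : ∀ m k → suc k * bin (suc m) (suc k) ≡ suc m * bin m k
bin-absorb zero zero = refl
bin-absorb zero (suc k) = ℕₚ.*-zeroʳ (suc (suc k))
bin-absorb (suc m) zero = trans (ℕₚ.*-identityˡ _) (trans (bin-1 (suc (suc m))) (≡.sym (ℕₚ.*-identityʳ _)))
bin-absorb (suc m) (suc j) = begin
    suc (suc j) * (bin (suc m) (suc j) + bin (suc m) (suc (suc j)))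
  ≡⟨ split (suc j) (bin (suc m) (suc j)) (bin (suc m) (suc (suc j))) ⟩
    suc j * bin (suc m) (suc j) + bin (suc m) (suc j) + suc (suc j) * bin (suc m) (suc (suc j))
  ≡⟨ cong₂ (λ x y → x + bin (suc m) (suc j) + y) (bin-absorb m j) (bin-absorb m (suc j)) ⟩
    suc m * bin m j + (bin m j + bin m (suc j)) + suc m * bin m (suc j)
  ≡⟨ merge m (bin m j) (bin m (suc j)) ⟩
    suc (suc m) * (bin m j + bin m (suc j))
  ∎
  where
  open ≡-Reasoning
  split : ∀ k x y → suc k * (x + y) ≡ k * x + x + suc k * y
  split = solve-∀
  merge : ∀ m x y → suc m * x + (x + y) + suc m * y ≡ suc (suc m) * (x + y)
  merge = solve-∀

bin-absorb-≤ : ∀ m k → suc k * bin m (suc k) ≤ m * bin m k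
bin-absorb-≤ zero k = ℕₚ.≤-reflexive (ℕₚ.*-zeroʳ (suc k))
bin-absorb-≤ (suc m) k =
  ℕₚ.≤-trans (ℕₚ.≤-reflexive (bin-absorb m k)) (ℕₚ.*-monoʳ-≤ (suc m) (bin-mono m k))

+≡⇒∸≡ : ∀ {a m n} → a + m ≡ n → n ∸ a ≡ m
+≡⇒∸≡ {a} {m} refl = ℕₚ.m+n∸m≡n a m

combs : ∀ {a} {A : Set a} → ℕ → List A → List (List A)
combs zero L = [] ∷ []
combs (suc k) [] = []
combs (suc k) (x ∷ L) = map (x ∷_) (combs k L) ++ combs (suc k) L

module _ {a} {A : Set a} where

  ∑-combs : ∀ k x (L : List A) (f : List A → ℕ) →
            ∑ (combs (suc k) (x ∷ L)) f ≡ ∑ (combs k L) (λ S → f (x ∷ S)) + ∑ (combs (suc k) L) f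
  ∑-combs k x L f =
    trans (∑-++ (map (x ∷_) (combs k L)) (combs (suc k) L) f)
          (cong₂ _+_ (∑-map (x ∷_) (combs k L) f) refl)

  length-combs : ∀ k (L : List A) → length (combs k L) ≡ bin (length L) k
  length-combs zero L = ≡.sym (bin-0 (length L))
  length-combs (suc k) [] = refl
  length-combs (suc k) (x ∷ L) = begin
      length (map (x ∷_) (combs k L) ++ combs (suc k) L)
    ≡⟨ Lₚ.length-++ (map (x ∷_) (combs k L)) ⟩
      length (map (x ∷_) (combs k L)) + length (combs (suc k) L)
    ≡⟨ cong₂ _+_ (trans (Lₚ.length-map (x ∷_) (combs k L)) (length-combs k L)) (length-combs (suc k) L) ⟩
      bin (length L) k + bin (length L) (suc k)
    ∎
    where open ≡-Reasoning

  -- The k-sublists of L all of whose elements satisfy p are the k-sublists of filter p L.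
  ∑-combs-all : ∀ (p : A → Bool) k (L : List A) →
                ∑ (combs k L) (λ T → 𝟙 (all p T)) ≡ bin (length (filterᵇ p L)) k
  ∑-combs-all p zero L = ≡.sym (bin-0 (length (filterᵇ p L)))
  ∑-combs-all p (suc k) [] = refl
  ∑-combs-all p (suc k) (x ∷ L) rewrite ∑-combs k x L (λ T → 𝟙 (all p T)) with p x
  ... | true = cong₂ _+_ (∑-combs-all p k L) (∑-combs-all p (suc k) L)
  ... | false = cong₂ _+_ (∑-zero (combs k L)) (∑-combs-all p (suc k) L)

  ∑-combs-shift : ∀ (L : List A) (f : List A → ℕ) m → f [] ≡ 0 →
                  (∀ j → ∑ (combs (suc j) L) f ≡ bin m j) →
                  ∀ j → ∑ (combs j L) f + bin m j ≡ bin (suc m) j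
  ∑-combs-shift L f m f[]≡0 sums zero = cong₂ _+_ (trans (ℕₚ.+-identityʳ (f [])) f[]≡0) (bin-0 m)
  ∑-combs-shift L f m f[]≡0 sums (suc j) = cong₂ _+_ (sums j) refl

module Membership {A : Set} (_≟_ : DecidableEquality A) where

  _==_ : A → A → Bool
  x == y = ⌊ x ≟ y ⌋

  ==-refl : ∀ x → (x == x) ≡ true
  ==-refl x with x ≟ x
  ... | yes _ = refl
  ... | no x≢x = ⊥-elim (x≢x refl)

  ==-sound : ∀ {x y} → (x == y) ≡ true → x ≡ y
  ==-sound {x} {y} h with x ≟ y
  ... | yes x≡y = x≡y

  ==-sym : ∀ x y → (x == y) ≡ (y == x)
  ==-sym x y with x ≟ y | y ≟ x
  ... | yes _ | yes _ = refl
  ... | no _ | no _ = refl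
  ... | yes x≡y | no y≢x = ⊥-elim (y≢x (≡.sym x≡y))
  ... | no x≢y | yes y≡x = ⊥-elim (x≢y (≡.sym y≡x))

  ==-false : ∀ {x y} → x ≢ y → (x == y) ≡ false
  ==-false {x} {y} x≢y with x ≟ y
  ... | yes x≡y = ⊥-elim (x≢y x≡y)
  ... | no _ = refl

  _∈ᵇ_ : A → List A → Bool
  x ∈ᵇ [] = false
  x ∈ᵇ (y ∷ ys) = (x == y) ∨ (x ∈ᵇ ys)

  Distinct : List A → Set
  Distinct [] = ⊤
  Distinct (x ∷ xs) = (x ∈ᵇ xs) ≡ false × Distinct xs

  count-∉ : ∀ x L → (x ∈ᵇ L) ≡ false → ∑ L (λ y → 𝟙 (y == x)) ≡ 0
  count-∉ x [] _ = refl
  count-∉ x (y ∷ L) x∉ with ∨-false {x == y} x∉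
  ... | x≠y , x∉L rewrite ==-sym y x | x≠y = count-∉ x L x∉L

  count-∈ : ∀ x L → Distinct L → (x ∈ᵇ L) ≡ true → ∑ L (λ y → 𝟙 (y == x)) ≡ 1
  count-∈ x [] _ ()
  count-∈ x (y ∷ L) (y∉L , distinct) x∈ with x == y in x=y
  ... | true rewrite ==-sym y x | x=y | ==-sound x=y = cong suc (count-∉ y L y∉L)
  ... | false rewrite ==-sym y x | x=y = count-∈ x L distinct x∈

  ∈-filter : ∀ p x L → (x ∈ᵇ filterᵇ p L) ≡ true → (x ∈ᵇ L) ≡ true × p x ≡ true
  ∈-filter p x [] ()
  ∈-filter p x (y ∷ L) x∈ with p y in py
  ∈-filter p x (y ∷ L) x∈ | true with x == y in x=y
  ... | true rewrite ==-sound x=y = refl , py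
  ... | false = ∈-filter p x L x∈
  ∈-filter p x (y ∷ L) x∈ | false with ∈-filter p x L x∈
  ... | x∈L , px rewrite x∈L | ∨-zeroʳ (x == y) = refl , px

  ∉-filter : ∀ p x L → (x ∈ᵇ L) ≡ false → (x ∈ᵇ filterᵇ p L) ≡ false
  ∉-filter p x [] _ = refl
  ∉-filter p x (y ∷ L) x∉ with ∨-false {x == y} x∉
  ... | x≠y , x∉L with p y
  ... | true rewrite x≠y = ∉-filter p x L x∉L
  ... | false = ∉-filter p x L x∉L

  Distinct-filter : ∀ p L → Distinct L → Distinct (filterᵇ p L)
  Distinct-filter p [] _ = tt
  Distinct-filter p (x ∷ L) (x∉L , distinct) with p x
  ... | true = ∉-filter p x L x∉L , Distinct-filter p L distinct
  ... | false = Distinct-filter p L distinct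

  ∑-cong-∈ : ∀ L {f g : A → ℕ} → (∀ x → (x ∈ᵇ L) ≡ true → f x ≡ g x) → ∑ L f ≡ ∑ L g
  ∑-cong-∈ [] h = refl
  ∑-cong-∈ (y ∷ L) h =
    cong₂ _+_ (h y (cong (_∨ (y ∈ᵇ L)) (==-refl y)))
              (∑-cong-∈ L (λ x x∈ → h x (trans (cong ((x == y) ∨_) x∈) (∨-zeroʳ (x == y)))))

  ∑-≥-term : ∀ L (f : A → ℕ) x → (x ∈ᵇ L) ≡ true → f x ≤ ∑ L f
  ∑-≥-term [] f x ()
  ∑-≥-term (y ∷ L) f x x∈ with x == y in x=y
  ... | true rewrite ==-sound x=y = ℕₚ.m≤m+n (f y) _
  ... | false = ℕₚ.≤-trans (∑-≥-term L f x x∈) (ℕₚ.m≤n+m _ (f y))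

  all-∈ : ∀ p T y → all p T ≡ true → (y ∈ᵇ T) ≡ true → p y ≡ true
  all-∈ p [] y _ ()
  all-∈ p (x ∷ T) y all-p y∈ with p x in px | y == x in y=x
  ... | true | true rewrite ==-sound y=x = px
  ... | true | false = all-∈ p T y all-p y∈

  ∑-combs-∉ : ∀ j L v (X : List A → Bool) → (v ∈ᵇ L) ≡ false →
              ∑ (combs j L) (λ T → 𝟙 ((v ∈ᵇ T) ∧ X T)) ≡ 0
  ∑-combs-∉ zero L v X _ = refl
  ∑-combs-∉ (suc j) [] v X _ = refl
  ∑-combs-∉ (suc j) (x ∷ L) v X v∉ with ∨-false {v == x} v∉
  ... | v≠x , v∉L rewrite ∑-combs j x L (λ T → 𝟙 ((v ∈ᵇ T) ∧ X T)) | v≠x =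
    cong₂ _+_ (∑-combs-∉ j L v (λ S → X (x ∷ S)) v∉L) (∑-combs-∉ (suc j) L v X v∉L)

  ∈-tabulate : ∀ {m} (g : Fin m → A) i → (g i ∈ᵇ tabulate g) ≡ true
  ∈-tabulate g zero rewrite ==-refl (g zero) = refl
  ∈-tabulate g (suc i) rewrite ∈-tabulate (λ j → g (suc j)) i = ∨-zeroʳ (g (suc i) == g zero)

  ∈-tabulate⁻ : ∀ {m} (g : Fin m → A) x → (x ∈ᵇ tabulate g) ≡ true → Σ (Fin m) (λ i → x ≡ g i)
  ∈-tabulate⁻ {zero} g x ()
  ∈-tabulate⁻ {suc m} g x x∈ with x == g zero in x=g0
  ... | true = zero , ==-sound x=g0
  ... | false with ∈-tabulate⁻ (λ j → g (suc j)) x x∈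
  ... | i , x≡gi = suc i , x≡gi

  Distinct-tabulate : ∀ {m} (g : Fin m → A) → (∀ i j → g i ≡ g j → i ≡ j) → Distinct (tabulate g)
  Distinct-tabulate {zero} g injective = tt
  Distinct-tabulate {suc m} g injective =
    g0∉ , Distinct-tabulate (λ j → g (suc j)) (λ i j e → Finₚ.suc-injective (injective _ _ e))
    where
    g0∉ : (g zero ∈ᵇ tabulate (λ j → g (suc j))) ≡ false
    g0∉ with g zero ∈ᵇ tabulate (λ j → g (suc j)) in g0∈
    ... | false = refl
    ... | true with ∈-tabulate⁻ (λ j → g (suc j)) (g zero) g0∈
    ... | i , g0≡gi with injective _ _ g0≡gi
    ... | ()

  -- Isolated elements of sublists, relative to an irreflexive Boolean relation d
  -- (in the application, d v w says that w is a non-neighbour of v).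
  module Isolation (d : A → A → Bool) (d-irrefl : ∀ v → d v v ≡ false) where

    compatible : A → A → Bool
    compatible v w = (w == v) ∨ d v w

    isolatedIn : List A → A → Bool
    isolatedIn T v = (v ∈ᵇ T) ∧ all (compatible v) T

    compatible-off : ∀ v L → (v ∈ᵇ L) ≡ false →
                     length (filterᵇ (compatible v) L) ≡ length (filterᵇ (d v) L)
    compatible-off v L v∉L =
      trans (length-filter (compatible v) L)
        (trans (∑-cong-∈ L (λ w w∈ → cong 𝟙 (cong (_∨ d v w) (w≠v w w∈))))
               (≡.sym (length-filter (d v) L)))
      where
      w≠v : ∀ w → (w ∈ᵇ L) ≡ true → (w == v) ≡ false
      w≠v w w∈ with w == v in w=v
      ... | false = refl
      ... | true with ==-sound w=v
      ... | refl with trans (≡.sym w∈) v∉L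
      ... | ()

    -- For v ∈ L, the (j+1)-sublists of L in which v is isolated are v together with a
    -- j-sublist of {w ∈ L : d v w}; hence there are C(#{w ∈ L : d v w}, j) of them.
    isolated-count : ∀ j L v → Distinct L → (v ∈ᵇ L) ≡ true →
      ∑ (combs (suc j) L) (λ T → 𝟙 (isolatedIn T v)) ≡ bin (length (filterᵇ (d v) L)) j
    isolated-count j [] v _ ()
    isolated-count j (x ∷ L) v (x∉L , distinct) v∈
      rewrite ∑-combs j x L (λ T → 𝟙 (isolatedIn T v)) with v == x in v=x
    ... | true with ==-sound v=x
    ...   | refl rewrite ==-refl v | d-irrefl v =
      trans (cong₂ _+_ (trans (∑-combs-all (compatible v) j L)
                              (cong (λ m → bin m j) (compatible-off v L x∉L)))
                       (∑-combs-∉ (suc j) L v (all (compatible v)) x∉L))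
            (ℕₚ.+-identityʳ _)
    isolated-count j (x ∷ L) v (x∉L , distinct) v∈ | false rewrite ==-sym x v | v=x with d v x
    ... | true = trans (cong₂ _+_ refl (isolated-count j L v distinct v∈))
                       (∑-combs-shift L (λ T → 𝟙 (isolatedIn T v)) _ refl
                          (λ j′ → isolated-count j′ L v distinct v∈) j)
    ... | false = cong₂ _+_ (trans (∑-cong (combs j L) (λ S → cong 𝟙 (∧-zeroʳ (v ∈ᵇ S))))
                                   (∑-zero (combs j L)))
                            (isolated-count j L v distinct v∈)

    #isolated : List A → List A → ℕ
    #isolated L T = length (filterᵇ (isolatedIn T) L)

    ∑-#isolated : ∀ j L → Distinct L →
      ∑ (combs (suc j) L) (#isolated L) ≡ ∑ L (λ v → bin (length (filterᵇ (d v) L)) j)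
    ∑-#isolated j L distinct = begin
        ∑ (combs (suc j) L) (#isolated L)
      ≡⟨ ∑-cong (combs (suc j) L) (λ T → length-filter (isolatedIn T) L) ⟩
        ∑ (combs (suc j) L) (λ T → ∑ L (λ v → 𝟙 (isolatedIn T v)))
      ≡⟨ ∑-swap (combs (suc j) L) L (λ T v → 𝟙 (isolatedIn T v)) ⟩
        ∑ L (λ v → ∑ (combs (suc j) L) (λ T → 𝟙 (isolatedIn T v)))
      ≡⟨ ∑-cong-∈ L (λ v v∈ → isolated-count j L v distinct v∈) ⟩
        ∑ L (λ v → bin (length (filterᵇ (d v) L)) j)
      ∎
      where open ≡-Reasoning

module FinMembership {n : ℕ} = Membership (Fin._≟_ {n})
open FinMembership

∈-allFin : ∀ {n} (x : Fin n) → (x ∈ᵇ allFin n) ≡ true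
∈-allFin x = ∈-tabulate (λ i → i) x

Distinct-allFin : ∀ {n} → Distinct (allFin n)
Distinct-allFin = Distinct-tabulate (λ i → i) (λ i j i≡j → i≡j)

count-allFin : ∀ {n} (u : Fin n) → ∑ (allFin n) (λ w → 𝟙 (w == u)) ≡ 1
count-allFin {n} u = count-∈ u (allFin n) Distinct-allFin (∈-allFin u)

∑-allFin-suc : ∀ {n} (f : Fin (suc n) → ℕ) → ∑ (allFin (suc n)) f ≡ f zero + ∑ (allFin n) (λ i → f (suc i))
∑-allFin-suc {n} f = cong (_+_ (f zero))
  (trans (cong (λ xs → ∑ xs f) (≡.sym (Lₚ.map-tabulate (λ i → i) suc))) (∑-map suc (allFin n) f))

∑-allFin-∈ : ∀ {n} (L : List (Fin n)) → Distinct L → ∑ (allFin n) (λ i → 𝟙 (i ∈ᵇ L)) ≡ length L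
∑-allFin-∈ {n} [] _ = ∑-zero (allFin n)
∑-allFin-∈ {n} (x ∷ L) (x∉L , distinct) = begin
    ∑ (allFin n) (λ i → 𝟙 ((i == x) ∨ (i ∈ᵇ L)))
  ≡⟨ ∑-cong (allFin n) split ⟩
    ∑ (allFin n) (λ i → 𝟙 (i == x) + 𝟙 (i ∈ᵇ L))
  ≡⟨ ∑-+ (allFin n) _ _ ⟩
    ∑ (allFin n) (λ i → 𝟙 (i == x)) + ∑ (allFin n) (λ i → 𝟙 (i ∈ᵇ L))
  ≡⟨ cong₂ _+_ (count-allFin x) (∑-allFin-∈ L distinct) ⟩
    suc (length L)
  ∎
  where
  open ≡-Reasoning
  split : ∀ i → 𝟙 ((i == x) ∨ (i ∈ᵇ L)) ≡ 𝟙 (i == x) + 𝟙 (i ∈ᵇ L)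
  split i with i == x in i=x
  ... | false = refl
  ... | true rewrite ==-sound i=x | x∉L = refl

∣tabulate∣ : ∀ {n} (f : Fin n → Bool) → ∣ Vec.tabulate f ∣ ≡ ∑ (allFin n) (λ i → 𝟙 (f i))
∣tabulate∣ {zero} f = refl
∣tabulate∣ {suc n} f = trans (cons (f zero)) (≡.sym (∑-allFin-suc (λ i → 𝟙 (f i))))
  where
  cons : ∀ b → ∣ b Vec.∷ Vec.tabulate (λ i → f (suc i)) ∣ ≡ 𝟙 b + ∑ (allFin n) (λ i → 𝟙 (f (suc i)))
  cons true = cong suc (∣tabulate∣ (λ i → f (suc i)))
  cons false = ∣tabulate∣ (λ i → f (suc i))

count≡∑ : ∀ {n} (p : Fin n → Bool) → count p ≡ ∑ (allFin n) (λ w → 𝟙 (p w))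
count≡∑ {n} p = go (allFin n)
  where
  go : ∀ xs → length (filter (λ w → p w Bool.≟ true) xs) ≡ ∑ xs (λ w → 𝟙 (p w))
  go [] = refl
  go (x ∷ xs) with p x
  ... | true = cong suc (go xs)
  ... | false = go xs

∑-allFin-1 : ∀ {n} → ∑ (allFin n) (λ _ → 1) ≡ n
∑-allFin-1 {n} = trans (∑-const (allFin n) 1) (trans (ℕₚ.*-identityʳ _) (Lₚ.length-tabulate (λ i → i)))

<ᵇ-true : ∀ {m n} → m < n → (m <ᵇ n) ≡ true
<ᵇ-true {m} {n} m<n with m <ᵇ n in m<ᵇn
... | true = refl
... | false = ⊥-elim (subst T m<ᵇn (ℕₚ.<⇒<ᵇ m<n))

<ᵇ-false : ∀ {m n} → ¬ (m < n) → (m <ᵇ n) ≡ false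
<ᵇ-false {m} {n} m≮n with m <ᵇ n in m<ᵇn
... | false = refl
... | true = ⊥-elim (m≮n (ℕₚ.<ᵇ⇒< m n (subst T (≡.sym m<ᵇn) tt)))

order-split : ∀ {n} (u v : Fin n) x →
  onlyIf (Fin.toℕ u <ᵇ Fin.toℕ v) x + onlyIf (Fin.toℕ v <ᵇ Fin.toℕ u) x ≡ onlyIf (not (u == v)) x
order-split u v x with ℕₚ.<-cmp (Fin.toℕ u) (Fin.toℕ v)
... | tri< u<v _ v≮u rewrite <ᵇ-true u<v | <ᵇ-false v≮u | ==-false (λ u≡v → ℕₚ.<⇒≢ u<v (cong Fin.toℕ u≡v)) =
  ℕₚ.+-identityʳ x
... | tri> u≮v _ v<u rewrite <ᵇ-false u≮v | <ᵇ-true v<u | ==-false (λ u≡v → ℕₚ.>⇒≢ v<u (cong Fin.toℕ u≡v)) =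
  refl
... | tri≈ u≮v u≡v v≮u rewrite <ᵇ-false u≮v | <ᵇ-false v≮u | Finₚ.toℕ-injective u≡v | ==-refl v = refl

and-pairs : ∀ {a b} {A : Set a} {B : Set b} (g : A → B → Bool) xs ys → (∀ x y → g x y ≡ true) →
            foldr _∧_ true (concatMap (λ x → map (g x) ys) xs) ≡ true
and-pairs g [] ys h = refl
and-pairs g (x ∷ xs) ys h = row ys
  where
  row : ∀ zs → foldr _∧_ true (map (g x) zs ++ concatMap (λ x → map (g x) ys) xs) ≡ true
  row [] = and-pairs g xs ys h
  row (z ∷ zs) rewrite h x z = row zs

≤-max-allSubsets : ∀ {m} (S : Subset m) (F : Subset m → ℕ) → F S ≤ foldr _⊔_ 0 (map F (allSubsets m))
≤-max-allSubsets {zero} Vec.[] F = ℕₚ.m≤m⊔n (F Vec.[]) 0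
≤-max-allSubsets {suc m} (b Vec.∷ S) F =
  ℕₚ.≤-trans (≤-max-allSubsets S (λ S′ → F (b Vec.∷ S′))) (extend b (allSubsets m))
  where
  extend : ∀ b xs → foldr _⊔_ 0 (map (λ S′ → F (b Vec.∷ S′)) xs) ≤
                    foldr _⊔_ 0 (map F (concatMap (λ S → (false Vec.∷ S) ∷ (true Vec.∷ S) ∷ []) xs))
  extend b [] = z≤n
  extend false (x ∷ xs) =
    ℕₚ.⊔-monoʳ-≤ (F (false Vec.∷ x)) (ℕₚ.≤-trans (extend false xs) (ℕₚ.m≤n⊔m (F (true Vec.∷ x)) _))
  extend true (x ∷ xs) =
    ℕₚ.≤-trans (ℕₚ.⊔-monoʳ-≤ (F (true Vec.∷ x)) (extend true xs)) (ℕₚ.m≤n⊔m (F (false Vec.∷ x)) _)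

≤-indepNum : ∀ {n} (G : Graph n) (L : List (Fin n)) → Distinct L →
             (∀ x y → (x ∈ᵇ L) ≡ true → (y ∈ᵇ L) ≡ true → adj G x y ≡ false) → length L ≤ indepNum G
≤-indepNum {n} G L distinct independent = begin
    length L
  ≡⟨ ≡.sym (trans (∣tabulate∣ (λ i → i ∈ᵇ L)) (∑-allFin-∈ L distinct)) ⟩
    ∣ S ∣
  ≡⟨ cong (λ b → if b then ∣ S ∣ else 0) S-independent ⟨
    (if independent? G S then ∣ S ∣ else 0)
  ≤⟨ ≤-max-allSubsets S (λ S → if independent? G S then ∣ S ∣ else 0) ⟩
    indepNum G
  ∎
  where
  open ℕₚ.≤-Reasoning
  S : Subset n
  S = Vec.tabulate (λ i → i ∈ᵇ L)
  pair-ok : ∀ a b → not (Vec.lookup S a ∧ Vec.lookup S b ∧ adj G a b) ≡ true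
  pair-ok a b rewrite Vecₚ.lookup∘tabulate (λ i → i ∈ᵇ L) a | Vecₚ.lookup∘tabulate (λ i → i ∈ᵇ L) b
    with a ∈ᵇ L in a∈ | b ∈ᵇ L in b∈
  ... | false | _ = refl
  ... | true | false = refl
  ... | true | true rewrite independent a b a∈ b∈ = refl
  S-independent : independent? G S ≡ true
  S-independent =
    and-pairs (λ a b → not (Vec.lookup S a ∧ Vec.lookup S b ∧ adj G a b)) (allFin n) (allFin n) pair-ok

∑ℤ : List ℤ → ℤ
∑ℤ = foldr ℤ._+_ (+ 0)

∑ℤ-++ : ∀ xs ys → ∑ℤ (xs ++ ys) ≡ ∑ℤ xs ℤ.+ ∑ℤ ys
∑ℤ-++ [] ys = ≡.sym (ℤₚ.+-identityˡ (∑ℤ ys))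
∑ℤ-++ (x ∷ xs) ys = trans (cong (ℤ._+_ x) (∑ℤ-++ xs ys)) (≡.sym (ℤₚ.+-assoc x (∑ℤ xs) (∑ℤ ys)))

diff-+ : ∀ a b c d → (+ a ℤ.- + b) ℤ.+ (+ c ℤ.- + d) ≡ + (a + c) ℤ.- + (b + d)
diff-+ a b c d rewrite ℤₚ.pos-+ a c | ℤₚ.pos-+ b d = interchange (+ a) (+ b) (+ c) (+ d)
  where interchange : ∀ (a b c d : ℤ) → (a ℤ.- b) ℤ.+ (c ℤ.- d) ≡ (a ℤ.+ c) ℤ.- (b ℤ.+ d)
        interchange = ℤ-solve-∀

diff-onlyIf : ∀ b x y → (if b then + x ℤ.- + y else + 0) ≡ + onlyIf b x ℤ.- + onlyIf b y
diff-onlyIf true x y = refl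
diff-onlyIf false x y = refl

module _ {A B : Set} (c : A → B → Bool) (f h : A → B → ℕ) where

  ∑ℤ-differences : ∀ us vs →
    ∑ℤ (concatMap (λ u → map (λ v → if c u v then + f u v ℤ.- + h u v else + 0) vs) us)
      ≡ + ∑ us (λ u → ∑ vs (λ v → onlyIf (c u v) (f u v))) ℤ.- + ∑ us (λ u → ∑ vs (λ v → onlyIf (c u v) (h u v)))
  ∑ℤ-differences [] vs = refl
  ∑ℤ-differences (u ∷ us) vs =
    trans (∑ℤ-++ (map _ vs) (concatMap _ us))
          (trans (cong₂ ℤ._+_ (row vs) (∑ℤ-differences us vs))
                 (diff-+ (∑ vs (λ v → onlyIf (c u v) (f u v))) (∑ vs (λ v → onlyIf (c u v) (h u v)))
                         (∑ us (λ u → ∑ vs (λ v → onlyIf (c u v) (f u v))))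
                         (∑ us (λ u → ∑ vs (λ v → onlyIf (c u v) (h u v))))))
    where
    row : ∀ vs → ∑ℤ (map (λ v → if c u v then + f u v ℤ.- + h u v else + 0) vs)
                   ≡ + ∑ vs (λ v → onlyIf (c u v) (f u v)) ℤ.- + ∑ vs (λ v → onlyIf (c u v) (h u v))
    row [] = refl
    row (v ∷ vs) = trans (cong₂ ℤ._+_ (diff-onlyIf (c u v) (f u v) (h u v)) (row vs))
                         (diff-+ (onlyIf (c u v) (f u v)) (onlyIf (c u v) (h u v))
                                 (∑ vs (λ v → onlyIf (c u v) (f u v))) (∑ vs (λ v → onlyIf (c u v) (h u v))))

ℕ⇒ℤ-bound : ∀ X α a P Q → X * a + (Q + Q) ≤ α * a + (P + P) →
            + X ℤ.* + a ℤ.≤ + α ℤ.* + a ℤ.+ + 2 ℤ.* (+ P ℤ.- + Q)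
ℕ⇒ℤ-bound X α a P Q h = begin
    + X ℤ.* + a
  ≡⟨ cancel (+ X ℤ.* + a) (+ Q) ⟨
    + X ℤ.* + a ℤ.+ (+ Q ℤ.+ + Q) ℤ.- (+ Q ℤ.+ + Q)
  ≤⟨ ℤₚ.+-monoˡ-≤ (ℤ.- (+ Q ℤ.+ + Q)) (subst₂ ℤ._≤_ (cast X a Q) (cast α a P) (ℤ.+≤+ h)) ⟩
    + α ℤ.* + a ℤ.+ (+ P ℤ.+ + P) ℤ.- (+ Q ℤ.+ + Q)
  ≡⟨ regroup (+ α ℤ.* + a) (+ P) (+ Q) ⟩
    + α ℤ.* + a ℤ.+ + 2 ℤ.* (+ P ℤ.- + Q)
  ∎
  where
  open ℤₚ.≤-Reasoning
  cast : ∀ x a y → + (x * a + (y + y)) ≡ + x ℤ.* + a ℤ.+ (+ y ℤ.+ + y)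
  cast x a y = trans (ℤₚ.pos-+ (x * a) (y + y)) (cong₂ ℤ._+_ (ℤₚ.pos-* x a) (ℤₚ.pos-+ y y))
  cancel : ∀ (x q : ℤ) → x ℤ.+ (q ℤ.+ q) ℤ.- (q ℤ.+ q) ≡ x
  cancel = ℤ-solve-∀
  regroup : ∀ (y p q : ℤ) → y ℤ.+ (p ℤ.+ p) ℤ.- (q ℤ.+ q) ≡ y ℤ.+ + 2 ℤ.* (p ℤ.- q)
  regroup = ℤ-solve-∀

ratio-bound : ∀ X α a (b : ℤ) → 1 ≤ a → + X ℤ.* + a ℤ.≤ + α ℤ.* + a ℤ.+ b →
              (+ X) ℚ./ 1 ℚ.- ratio b a ℚ.≤ (+ α) ℚ./ 1
ratio-bound X α (suc k) b _ h =
  ℚₚ.toℚᵘ-cancel-≤ (ℚᵘₚ.≤-respʳ-≃ (ℚᵘₚ.≃-sym (ℚₚ.toℚᵘ-fromℚᵘ (mkℚᵘ (+ α) 0)))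
                     (ℚᵘₚ.≤-respˡ-≃ (ℚᵘₚ.≃-sym difference) unnormalised))
  where
  x y : ℚᵘ.ℚᵘ
  x = mkℚᵘ (+ X) 0
  y = mkℚᵘ b k
  difference : ℚ.toℚᵘ ((+ X) ℚ./ 1 ℚ.- b ℚ./ suc k) ℚᵘ.≃ x ℚᵘ.- y
  difference = ℚᵘₚ.≃-trans (ℚₚ.toℚᵘ-homo-+ ((+ X) ℚ./ 1) (ℚ.- (b ℚ./ suc k)))
                 (ℚᵘₚ.+-cong (ℚₚ.toℚᵘ-fromℚᵘ x)
                   (ℚᵘₚ.≃-trans (ℚₚ.toℚᵘ-homo‿- (b ℚ./ suc k)) (ℚᵘₚ.-‿cong (ℚₚ.toℚᵘ-fromℚᵘ y))))
  cross : ((+ X ℤ.* + suc k) ℤ.+ (ℤ.- b) ℤ.* + 1) ℤ.* + 1 ℤ.≤ + α ℤ.* + suc (k + 0)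
  cross = begin
      ((+ X ℤ.* + suc k) ℤ.+ (ℤ.- b) ℤ.* + 1) ℤ.* + 1
    ≡⟨ simplify (+ X ℤ.* + suc k) b ⟩
      + X ℤ.* + suc k ℤ.- b
    ≤⟨ ℤₚ.+-monoˡ-≤ (ℤ.- b) h ⟩
      + α ℤ.* + suc k ℤ.+ b ℤ.- b
    ≡⟨ cancel (+ α ℤ.* + suc k) b ⟩
      + α ℤ.* + suc k
    ≡⟨ cong (λ m → + α ℤ.* + suc m) (ℕₚ.+-identityʳ k) ⟨
      + α ℤ.* + suc (k + 0)
    ∎
    where
    open ℤₚ.≤-Reasoning
    simplify : ∀ (p q : ℤ) → (p ℤ.+ (ℤ.- q) ℤ.* + 1) ℤ.* + 1 ≡ p ℤ.- q
    simplify = ℤ-solve-∀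
    cancel : ∀ (p q : ℤ) → p ℤ.+ q ℤ.- q ≡ p
    cancel = ℤ-solve-∀
  unnormalised : x ℚᵘ.- y ℚᵘ.≤ mkℚᵘ (+ α) 0
  unnormalised = ℚᵘ.*≤* cross

module _ {n : ℕ} (G : Graph n) where

  V : List (Fin n)
  V = allFin n

  nonAdj : Fin n → Fin n → Bool
  nonAdj u w = not (u == w) ∧ not (adj G u w)

  nonAdj-irrefl : ∀ v → nonAdj v v ≡ false
  nonAdj-irrefl v rewrite ==-refl v = refl

  nonAdj⇒¬adj : ∀ {u w} → nonAdj u w ≡ true → adj G u w ≡ false
  nonAdj⇒¬adj {u} {w} h with adj G u w
  ... | false = refl
  ... | true with trans (≡.sym h) (∧-zeroʳ (not (u == w)))
  ... | ()

  nonNbrs : Fin n → List (Fin n)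
  nonNbrs u = filterᵇ (nonAdj u) V

  Distinct-nonNbrs : ∀ u → Distinct (nonNbrs u)
  Distinct-nonNbrs u = Distinct-filter (nonAdj u) V Distinct-allFin

  trichotomy-at : ∀ u w → 𝟙 (adj G u w) + (𝟙 (w == u) + 𝟙 (nonAdj u w)) ≡ 1
  trichotomy-at u w rewrite ==-sym w u with u == w in u=w
  ... | true rewrite ==-sound u=w | irrfl G w = refl
  ... | false with adj G u w
  ... | true = refl
  ... | false = refl

  length-nonNbrs : ∀ u → length (nonNbrs u) ≡ n ∸ deg G u ∸ 1
  length-nonNbrs u = ≡.sym (cong (_∸ 1) (+≡⇒∸≡ {deg G u} partition))
    where
    open ≡-Reasoning
    partition : deg G u + suc (length (nonNbrs u)) ≡ n
    partition = begin
        deg G u + (1 + length (nonNbrs u))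
      ≡⟨ cong₂ _+_ (count≡∑ (adj G u)) (cong₂ _+_ (≡.sym (count-allFin u)) (length-filter (nonAdj u) V)) ⟩
        ∑ V (λ w → 𝟙 (adj G u w)) + (∑ V (λ w → 𝟙 (w == u)) + ∑ V (λ w → 𝟙 (nonAdj u w)))
      ≡⟨ cong (_+_ (∑ V (λ w → 𝟙 (adj G u w)))) (∑-+ V _ _) ⟨
        ∑ V (λ w → 𝟙 (adj G u w)) + ∑ V (λ w → 𝟙 (w == u) + 𝟙 (nonAdj u w))
      ≡⟨ ∑-+ V _ _ ⟨
        ∑ V (λ w → 𝟙 (adj G u w) + (𝟙 (w == u) + 𝟙 (nonAdj u w)))
      ≡⟨ trans (∑-cong V (trichotomy-at u)) ∑-allFin-1 ⟩
        n
      ∎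

  inClosedUnion : Fin n → Fin n → Fin n → Bool
  inClosedUnion u v w = (w == u) ∨ (w == v) ∨ adj G u w ∨ adj G v w

  closedUnionSize-sym : ∀ u v → closedUnionSize G u v ≡ closedUnionSize G v u
  closedUnionSize-sym u v =
    trans (count≡∑ (inClosedUnion u v)) (trans (∑-cong V swap) (≡.sym (count≡∑ (inClosedUnion v u))))
    where
    swap : ∀ w → 𝟙 (inClosedUnion u v w) ≡ 𝟙 (inClosedUnion v u w)
    swap w with w == u | w == v | adj G u w | adj G v w
    ... | true | true | _ | _ = refl
    ... | true | false | _ | _ = refl
    ... | false | true | _ | _ = refl
    ... | false | false | true | true = refl
    ... | false | false | true | false = refl
    ... | false | false | false | true = refl
    ... | false | false | false | false = refl

  union-or-common : ∀ u v w → 𝟙 (inClosedUnion u v w) + onlyIf (nonAdj u w) (𝟙 (nonAdj v w)) ≡ 1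
  union-or-common u v w rewrite ==-sym u w | ==-sym v w with w == u | w == v | adj G u w | adj G v w
  ... | true | _ | _ | _ = refl
  ... | false | true | true | _ = refl
  ... | false | true | false | _ = refl
  ... | false | false | true | _ = refl
  ... | false | false | false | true = refl
  ... | false | false | false | false = refl

  length-common : ∀ u v → length (filterᵇ (nonAdj v) (nonNbrs u)) ≡ n ∸ closedUnionSize G u v
  length-common u v = ≡.sym (+≡⇒∸≡ {closedUnionSize G u v} partition)
    where
    open ≡-Reasoning
    partition : closedUnionSize G u v + length (filterᵇ (nonAdj v) (nonNbrs u)) ≡ n
    partition = begin
        closedUnionSize G u v + length (filterᵇ (nonAdj v) (nonNbrs u))
      ≡⟨ cong₂ _+_ (count≡∑ (inClosedUnion u v))
                   (trans (length-filter (nonAdj v) (nonNbrs u))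
                          (∑-filter (nonAdj u) V (λ w → 𝟙 (nonAdj v w)))) ⟩
        ∑ V (λ w → 𝟙 (inClosedUnion u v w)) + ∑ V (λ w → onlyIf (nonAdj u w) (𝟙 (nonAdj v w)))
      ≡⟨ ∑-+ V _ _ ⟨
        ∑ V (λ w → 𝟙 (inClosedUnion u v w) + onlyIf (nonAdj u w) (𝟙 (nonAdj v w)))
      ≡⟨ trans (∑-cong V (union-or-common u v)) ∑-allFin-1 ⟩
        n
      ∎

  open Isolation nonAdj nonAdj-irrefl

  -- For any T, the vertex u together with the vertices of M(u) isolated in T is independent.
  isolated-independent : ∀ u T → suc (#isolated (nonNbrs u) T) ≤ indepNum G
  isolated-independent u T =
    ≤-indepNum G (u ∷ I) (u∉I , Distinct-filter (isolatedIn T) (nonNbrs u) (Distinct-nonNbrs u)) independent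
    where
    I : List (Fin n)
    I = filterᵇ (isolatedIn T) (nonNbrs u)
    ∈I : ∀ x → (x ∈ᵇ I) ≡ true → nonAdj u x ≡ true × isolatedIn T x ≡ true
    ∈I x x∈ with ∈-filter (isolatedIn T) x (nonNbrs u) x∈
    ... | x∈M , isolated = proj₂ (∈-filter (nonAdj u) x V x∈M) , isolated
    u∉I : (u ∈ᵇ I) ≡ false
    u∉I with u ∈ᵇ I in u∈
    ... | false = refl
    ... | true with trans (≡.sym (proj₁ (∈I u u∈))) (nonAdj-irrefl u)
    ... | ()
    independent : ∀ x y → (x ∈ᵇ (u ∷ I)) ≡ true → (y ∈ᵇ (u ∷ I)) ≡ true → adj G x y ≡ false
    independent x y x∈ y∈ with x == u in x=u | y == u in y=u
    ... | true | true rewrite ==-sound x=u | ==-sound y=u = irrfl G u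
    ... | true | false rewrite ==-sound x=u = nonAdj⇒¬adj (proj₁ (∈I y y∈))
    ... | false | true rewrite ==-sound y=u = trans (Graph.sym G x u) (nonAdj⇒¬adj (proj₁ (∈I x x∈)))
    ... | false | false with ∈I x x∈ | ∈I y y∈
    ... | _ , x-isolated | _ , y-isolated with y == x in y=x
    ...   | true rewrite ==-sound y=x = irrfl G x
    ...   | false = nonAdj⇒¬adj (trans (cong (_∨ nonAdj x y) (≡.sym y=x)) y-compatible)
      where
      y-compatible : compatible x y ≡ true
      y-compatible = all-∈ (compatible x) T y (proj₂ (∧-true x-isolated)) (proj₁ (∧-true y-isolated))

  vertex-bound : ∀ u k → let m = length (nonNbrs u) in
    bin m (suc k) + ∑ (nonNbrs u) (λ v → (n ∸ closedUnionSize G u v) C k) ≤ bin m (suc k) * indepNum G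
  vertex-bound u k = begin
      bin (length M) (suc k) + ∑ M (λ v → (n ∸ closedUnionSize G u v) C k)
    ≡⟨ cong₂ _+_ (≡.sym (trans (∑-const subsets 1) (trans (ℕₚ.*-identityʳ _) (length-combs (suc k) M))))
                 (∑-cong M common-count) ⟩
      ∑ subsets (λ _ → 1) + ∑ M (λ v → bin (length (filterᵇ (nonAdj v) M)) k)
    ≡⟨ cong (_+_ (∑ subsets (λ _ → 1))) (∑-#isolated k M (Distinct-nonNbrs u)) ⟨
      ∑ subsets (λ _ → 1) + ∑ subsets (#isolated M)
    ≡⟨ ∑-+ subsets (λ _ → 1) (#isolated M) ⟨
      ∑ subsets (λ T → suc (#isolated M T))
    ≤⟨ ∑-≤-const subsets (indepNum G) (isolated-independent u) ⟩
      length subsets * indepNum G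
    ≡⟨ cong (_* indepNum G) (length-combs (suc k) M) ⟩
      bin (length M) (suc k) * indepNum G
    ∎
    where
    open ℕₚ.≤-Reasoning
    M : List (Fin n)
    M = nonNbrs u
    subsets : List (List (Fin n))
    subsets = combs (suc k) M
    common-count : ∀ v → (n ∸ closedUnionSize G u v) C k ≡ bin (length (filterᵇ (nonAdj v) M)) k
    common-count v = trans (cong (_C k) (≡.sym (length-common u v))) (≡.sym (bin≡C _ k))

  -- Adding the absorption bound 2(k+1)·C(m, k+1) ≤ 2m·C(m, k) to `vertex-bound`, with m = n - d(u) - 1
  -- and S(u) = Σ_{v ∈ M(u)} C(n - |N[u] ∪ N[v]|, k):
  --   (2k+3)·C(m, k+1) + S(u) ≤ α(G)·C(m, k+1) + 2·|M(u)|·C(m, k).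
  vertex-inequality : ∀ u k → let m = n ∸ deg G u ∸ 1 in
    suc (2 * suc k) * (m C suc k) + ∑ (nonNbrs u) (λ v → (n ∸ closedUnionSize G u v) C k)
      ≤ indepNum G * (m C suc k) + 2 * (length (nonNbrs u) * (m C k))
  vertex-inequality u k = begin
      suc (2 * suc k) * ((n ∸ deg G u ∸ 1) C suc k) + S
    ≡⟨ cong (λ x → suc (2 * suc k) * x + S) (as-bin (suc k)) ⟨
      suc (2 * suc k) * c + S
    ≡⟨ regroup (suc k) c S ⟩
      2 * (suc k * c) + (c + S)
    ≤⟨ ℕₚ.+-mono-≤ (ℕₚ.*-monoʳ-≤ 2 (bin-absorb-≤ m k)) (vertex-bound u k) ⟩
      2 * (m * bin m k) + c * indepNum G
    ≡⟨ trans (ℕₚ.+-comm (2 * (m * bin m k)) (c * indepNum G))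
             (cong (_+ 2 * (m * bin m k)) (ℕₚ.*-comm c (indepNum G))) ⟩
      indepNum G * c + 2 * (m * bin m k)
    ≡⟨ cong₂ (λ x y → indepNum G * x + 2 * (m * y)) (as-bin (suc k)) (as-bin k) ⟩
      indepNum G * ((n ∸ deg G u ∸ 1) C suc k) + 2 * (m * ((n ∸ deg G u ∸ 1) C k))
    ∎
    where
    open ℕₚ.≤-Reasoning
    m c S : ℕ
    m = length (nonNbrs u)
    c = bin m (suc k)
    S = ∑ (nonNbrs u) (λ v → (n ∸ closedUnionSize G u v) C k)
    as-bin : ∀ j → bin m j ≡ (n ∸ deg G u ∸ 1) C j
    as-bin j = trans (bin≡C m j) (cong (_C j) (length-nonNbrs u))
    regroup : ∀ j c S → suc (2 * j) * c + S ≡ 2 * (j * c) + (c + S)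
    regroup = solve-∀

  below : Fin n → Fin n → Bool
  below u v = (Fin.toℕ u <ᵇ Fin.toℕ v) ∧ not (adj G u v)

  below-split : ∀ u v x → onlyIf (below u v) x + onlyIf (below v u) x ≡ onlyIf (nonAdj u v) x
  below-split u v x = begin
      onlyIf (below u v) x + onlyIf (below v u) x
    ≡⟨ cong₂ _+_ (onlyIf-∧ (Fin.toℕ u <ᵇ Fin.toℕ v) (not (adj G u v)) x)
                 (trans (cong (λ b → onlyIf ((Fin.toℕ v <ᵇ Fin.toℕ u) ∧ not b) x) (Graph.sym G v u))
                        (onlyIf-∧ (Fin.toℕ v <ᵇ Fin.toℕ u) (not (adj G u v)) x)) ⟩
      onlyIf (Fin.toℕ u <ᵇ Fin.toℕ v) y + onlyIf (Fin.toℕ v <ᵇ Fin.toℕ u) y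
    ≡⟨ order-split u v y ⟩
      onlyIf (not (u == v)) y
    ≡⟨ onlyIf-∧ (not (u == v)) (not (adj G u v)) x ⟨
      onlyIf (nonAdj u v) x
    ∎
    where
    open ≡-Reasoning
    y : ℕ
    y = onlyIf (not (adj G u v)) x

  ∑-nonEdges : ∀ (F : Fin n → Fin n → ℕ) →
    ∑ V (λ u → ∑ V (λ v → onlyIf (below u v) (F u v))) + ∑ V (λ u → ∑ V (λ v → onlyIf (below u v) (F v u)))
      ≡ ∑ V (λ u → ∑ (nonNbrs u) (F u))
  ∑-nonEdges F = begin
      ∑ V (λ u → ∑ V (λ v → onlyIf (below u v) (F u v))) + ∑ V (λ u → ∑ V (λ v → onlyIf (below u v) (F v u)))
    ≡⟨ cong (_+_ (∑ V (λ u → ∑ V (λ v → onlyIf (below u v) (F u v)))))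
            (∑-swap V V (λ u v → onlyIf (below u v) (F v u))) ⟩
      ∑ V (λ u → ∑ V (λ v → onlyIf (below u v) (F u v))) + ∑ V (λ u → ∑ V (λ v → onlyIf (below v u) (F u v)))
    ≡⟨ ∑-+ V _ _ ⟨
      ∑ V (λ u → ∑ V (λ v → onlyIf (below u v) (F u v)) + ∑ V (λ v → onlyIf (below v u) (F u v)))
    ≡⟨ ∑-cong V (λ u → ≡.sym (∑-+ V _ _)) ⟩
      ∑ V (λ u → ∑ V (λ v → onlyIf (below u v) (F u v) + onlyIf (below v u) (F u v)))
    ≡⟨ ∑-cong V (λ u → ∑-cong V (λ v → below-split u v (F u v))) ⟩
      ∑ V (λ u → ∑ V (λ v → onlyIf (nonAdj u v) (F u v)))
    ≡⟨ ∑-cong V (λ u → ∑-filter (nonAdj u) V (F u)) ⟨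
      ∑ V (λ u → ∑ (nonNbrs u) (F u))
    ∎
    where open ≡-Reasoning

  -- From here on t = k + 2.
  module _ (k : ℕ) where

    a-term : Fin n → ℕ
    a-term u = (n ∸ deg G u ∸ 1) C suc k

    deg-term : Fin n → ℕ
    deg-term u = (n ∸ deg G u ∸ 1) C k

    union-term : Fin n → Fin n → ℕ
    union-term u v = (n ∸ closedUnionSize G u v) C k

    -- The two parts of b(G, t)/2, summed over the non-edges {u, v} listed with u < v.
    pairs⁺ : ℕ
    pairs⁺ = ∑ V (λ u → ∑ V (λ v → onlyIf (below u v) (deg-term u + deg-term v)))

    pairs⁻ : ℕ
    pairs⁻ = ∑ V (λ u → ∑ V (λ v → onlyIf (below u v) (union-term u v)))

    b-as-pairs : bGt G (suc (suc k)) ≡ + 2 ℤ.* (+ pairs⁺ ℤ.- + pairs⁻)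
    b-as-pairs = cong (ℤ._*_ (+ 2)) (∑ℤ-differences below (λ u v → deg-term u + deg-term v) union-term V V)

    -- pairs⁺ = Σ_u |M(u)|·C(n - d(u) - 1, k), each non-edge contributing once from each end.
    pairs⁺-by-vertex : pairs⁺ ≡ ∑ V (λ u → length (nonNbrs u) * deg-term u)
    pairs⁺-by-vertex = begin
        pairs⁺
      ≡⟨ ∑-cong V (λ u → trans (∑-cong V (λ v → onlyIf-+ (below u v) (deg-term u) (deg-term v))) (∑-+ V _ _)) ⟩
        ∑ V (λ u → ∑ V (λ v → onlyIf (below u v) (deg-term u)) + ∑ V (λ v → onlyIf (below u v) (deg-term v)))
      ≡⟨ ∑-+ V _ _ ⟩
        ∑ V (λ u → ∑ V (λ v → onlyIf (below u v) (deg-term u))) + ∑ V (λ u → ∑ V (λ v → onlyIf (below u v) (deg-term v)))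
      ≡⟨ ∑-nonEdges (λ u v → deg-term u) ⟩
        ∑ V (λ u → ∑ (nonNbrs u) (λ v → deg-term u))
      ≡⟨ ∑-cong V (λ u → ∑-const (nonNbrs u) (deg-term u)) ⟩
        ∑ V (λ u → length (nonNbrs u) * deg-term u)
      ∎
      where open ≡-Reasoning

    -- 2·pairs⁻ = Σ_u Σ_{v ∈ M(u)} C(n - |N[u] ∪ N[v]|, k), by symmetry of the summand.
    pairs⁻-by-vertex : pairs⁻ + pairs⁻ ≡ ∑ V (λ u → ∑ (nonNbrs u) (union-term u))
    pairs⁻-by-vertex =
      trans (cong (_+_ pairs⁻) (∑-cong V (λ u → ∑-cong V (λ v → cong (onlyIf (below u v)) (flip u v)))))
            (∑-nonEdges union-term)
      where flip : ∀ u v → union-term u v ≡ union-term v u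
            flip u v = cong (λ s → (n ∸ s) C k) (closedUnionSize-sym u v)

    main-inequality : (2 * suc (suc k) ∸ 1) * ∑ V a-term + (pairs⁻ + pairs⁻)
                        ≤ indepNum G * ∑ V a-term + (pairs⁺ + pairs⁺)
    main-inequality = begin
        (2 * suc (suc k) ∸ 1) * ∑ V a-term + (pairs⁻ + pairs⁻)
      ≡⟨ cong₂ _+_ (trans (cong (λ x → (x ∸ 1) * ∑ V a-term) (ℕₚ.*-suc 2 (suc k)))
                          (≡.sym (∑-* V (suc (2 * suc k)) a-term)))
                   pairs⁻-by-vertex ⟩
        ∑ V (λ u → suc (2 * suc k) * a-term u) + ∑ V (λ u → ∑ (nonNbrs u) (union-term u))
      ≡⟨ ∑-+ V _ _ ⟨
        ∑ V (λ u → suc (2 * suc k) * a-term u + ∑ (nonNbrs u) (union-term u))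
      ≤⟨ ∑-mono V (λ u → vertex-inequality u k) ⟩
        ∑ V (λ u → indepNum G * a-term u + 2 * (length (nonNbrs u) * deg-term u))
      ≡⟨ ∑-+ V _ _ ⟩
        ∑ V (λ u → indepNum G * a-term u) + ∑ V (λ u → 2 * (length (nonNbrs u) * deg-term u))
      ≡⟨ cong₂ _+_ (∑-* V (indepNum G) a-term) (∑-* V 2 _) ⟩
        indepNum G * ∑ V a-term + 2 * ∑ V (λ u → length (nonNbrs u) * deg-term u)
      ≡⟨ cong (λ p → indepNum G * ∑ V a-term + 2 * p) pairs⁺-by-vertex ⟨
        indepNum G * ∑ V a-term + 2 * pairs⁺
      ≡⟨ cong (λ p → indepNum G * ∑ V a-term + (pairs⁺ + p)) (ℕₚ.+-identityʳ pairs⁺) ⟩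
        indepNum G * ∑ V a-term + (pairs⁺ + pairs⁺)
      ∎
      where open ℕₚ.≤-Reasoning

    integer-inequality : + (2 * suc (suc k) ∸ 1) ℤ.* + aGt G (suc (suc k))
                           ℤ.≤ + indepNum G ℤ.* + aGt G (suc (suc k)) ℤ.+ bGt G (suc (suc k))
    integer-inequality rewrite b-as-pairs =
      ℕ⇒ℤ-bound (2 * suc (suc k) ∸ 1) (indepNum G) (∑ V a-term) pairs⁺ pairs⁻ main-inequality

    -- a(G, t) > 0 for t ≤ n - δ: a vertex of minimum degree contributes C(n - δ - 1, t - 1) ≥ 1.
    a-positive : suc (suc k) ≤ n ∸ minDeg G → 1 ≤ aGt G (suc (suc k))
    a-positive t≤n-δ = ℕₚ.≤-trans term-positive (∑-≥-term V a-term u (∈-allFin u))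
      where
      δ<n : minDeg G < n
      δ<n = ℕₚ.m∸n≢0⇒n<m (λ n-δ≡0 → ℕₚ.<⇒≱ (s≤s z≤n) (ℕₚ.≤-trans t≤n-δ (ℕₚ.≤-reflexive n-δ≡0)))
      u : Fin n
      u = proj₁ (attained-min (deg G) n V δ<n)
      deg-u≤δ : deg G u ≤ minDeg G
      deg-u≤δ = proj₂ (attained-min (deg G) n V δ<n)
      m : ℕ
      m = n ∸ deg G u ∸ 1
      term-positive : 1 ≤ a-term u
      term-positive = subst (1 ≤_) (bin≡C m (suc k))
        (bin-pos m (suc k) (ℕₚ.∸-monoˡ-≤ 1 (ℕₚ.≤-trans t≤n-δ (ℕₚ.∸-monoʳ-≤ n deg-u≤δ))))

theorem3 : ∀ {n : ℕ} (G : Graph n) → Connected G → NonComplete G →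
    ∀ (t : ℕ) → 2 ≤ t → t ≤ n ∸ minDeg G →
    hmTerm G t ℚ.≤ ℚ._/_ (+ indepNum G) 1
theorem3 G _ _ (suc (suc k)) (s≤s (s≤s z≤n)) t≤n-δ =
  ratio-bound (2 * suc (suc k) ∸ 1) (indepNum G) (aGt G (suc (suc k))) (bGt G (suc (suc k)))
              (a-positive G k t≤n-δ) (integer-inequality G k)
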